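{- Let $t$ be a closed term and let $d \colon t \to_{\mathrm{cbv}}^{*} u$ with $\mathrm{normal}_{\mathrm{cbv}}(u)$. Then there is an evaluation sequence $d' \colon t \to_{\mathrm{need}}^{*} s$ with $\mathrm{normal}(s)$, $|d'|_m \leq |d|_m$ and $|d'|_e\leq |d|_e$.
   Context: Terms: $t,s ::= x \mid \lambda x.t \mid t\,s \mid t[x\leftarrow s]$, where $t[x\leftarrow s]$ (explicit substitution) binds $x$ in $t$; values $v ::= \lambda x.t$. $\mathrm{fv}(t[x\leftarrow s])=(\mathrm{fv}(t)\setminus\{x\})\cup\mathrm{fv}(s)$; closed means no free variables; terms up to $\alpha$-equivalence. Contexts (one hole $\langle\cdot\rangle$): weak (= CbV) contexts $V ::= \langle\cdot\rangle \mid V t \mid V[x\leftarrow t] \mid t V \mid t[x\leftarrow V]$; substitution contexts $S ::= \langle\cdot\rangle \mid S[x\leftarrow t]$; CbNeed contexts $E ::= \langle\cdot\rangle \mid E\,t \mid E[x\leftarrow t] \mid E\langle\langle x\rangle\rangle[x\leftarrow E']$. $W\langle t\rangle$ is plugging (may capture); $W\langle\langle t\rangle\rangle$ is plugging where the context does not capture free variables of $t$. Root steps: $S\langle\lambda x.t\rangle s \mapsto_m S\langle t[x\leftarrow s]\rangle$ (variables bound by $S$ disjoint from $\mathrm{fv}(s)$); $V\langle\langle x\rangle\rangle[x\leftarrow S\langle v\rangle]\mapsto_{e,\mathrm{cbv}} S\langle V\langle\langle v\rangle\rangle[x\leftarrow v]\rangle$ and $E\langle\langle x\rangle\rangle[x\leftarrow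 S\langle v\rangle] \mapsto_{e,\mathrm{need}} S\langle E\langle\langle v\rangle\rangle[x\leftarrow v]\rangle$ (variables bound by $S$ disjoint from the free variables of $V\langle\langle x\rangle\rangle$, resp. $E\langle\langle x\rangle\rangle$). $\to_{m,\mathrm{cbv}}$, $\to_{e,\mathrm{cbv}}$ are the closures of $\mapsto_m$, $\mapsto_{e,\mathrm{cbv}}$ under CbV contexts (relating $V\langle t'\rangle$ to $V\langle s'\rangle$ when $t'\mapsto s'$), $\to_{\mathrm{cbv}}$ their union; $\to_{m,\mathrm{need}},\to_{e,\mathrm{need}}$ are the closures of $\mapsto_m,\mapsto_{e,\mathrm{need}}$ under CbNeed contexts, $\to_{\mathrm{need}}$ their union. $|d|_m$, $|d|_e$ count multiplicative and exponential steps of $d$. $\mathrm{normal}$: least predicate with $\mathrm{normal}(\lambda x.t)$ and $\mathrm{normal}(t)\Rightarrow\mathrm{normal}(t[x\leftarrow s])$. $\mathrm{normal}_{\mathrm{cbv}}$: least predicate with $\mathrm{normal}_{\mathrm{cbv}}(\lambda x.t)$ and ($\mathrm{normal}_{\mathrm{cbv}}(t)$ and $\mathrm{normal}_{\mathrm{cbv}}(s)$) $\Rightarrow\mathrm{normal}_{\mathrm{cbv}}(t[x\leftarrow s])$. -}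

module Defs where

open import Data.Nat using (ℕ; zero; suc)
open import Data.Fin using (Fin; zero; suc)
open import Data.Sum using (_⊎_; inj₁; inj₂)
open import Relation.Binary.Construct.Closure.ReflexiveTransitive using (Star; ε; _◅_)

-- Well-scoped de Bruijn terms: Tm n = terms with free variables among n.
-- Terms are thus taken up to α-equivalence; closed terms are Tm 0.
data Tm : ℕ → Set where
  var : ∀ {n} → Fin n → Tm n
  lam : ∀ {n} → Tm (suc n) → Tm n              -- λx.t  (x = index 0 in t)
  app : ∀ {n} → Tm n → Tm n → Tm n
  es  : ∀ {n} → Tm (suc n) → Tm n → Tm n       -- es t s = t[x←s]  (x = index 0 in t)

Ren : ℕ → ℕ → Set
Ren n m = Fin n → Fin m

ext : ∀ {n m} → Ren n m → Ren (suc n) (suc m)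
ext ρ zero    = zero
ext ρ (suc i) = suc (ρ i)

rename : ∀ {n m} → Ren n m → Tm n → Tm m
rename ρ (var i)   = var (ρ i)
rename ρ (lam t)   = lam (rename (ext ρ) t)
rename ρ (app t s) = app (rename ρ t) (rename ρ s)
rename ρ (es t s)  = es (rename (ext ρ) t) (rename ρ s)

-- scope after going under k binders
_⊕_ : ℕ → ℕ → ℕ
n ⊕ zero  = n
n ⊕ suc k = suc n ⊕ k

-- weakening past k binders (used for capture-avoiding plugging ⟨⟨·⟩⟩)
wkN : ∀ {n} k → Ren n (n ⊕ k)
wkN zero    i = i
wkN (suc k) i = wkN k (suc i)

-- Weak (CbV) contexts: VCtx n k has outer scope n and its hole lies under k binders.
data VCtx : ℕ → ℕ → Set where
  hole : ∀ {n} → VCtx n zero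
  appL : ∀ {n k} → VCtx n k → Tm n → VCtx n k
  esL  : ∀ {n k} → VCtx (suc n) k → Tm n → VCtx n (suc k)
  appR : ∀ {n k} → Tm n → VCtx n k → VCtx n k
  esR  : ∀ {n k} → Tm (suc n) → VCtx n k → VCtx n k

plugV : ∀ {n k} → VCtx n k → Tm (n ⊕ k) → Tm n
plugV hole       u = u
plugV (appL V t) u = app (plugV V u) t
plugV (esL V t)  u = es (plugV V u) t
plugV (appR t V) u = app t (plugV V u)
plugV (esR t V)  u = es t (plugV V u)

renV : ∀ {n n' k} → Ren n n' → VCtx n k → VCtx n' k
renV ρ hole       = hole
renV ρ (appL V t) = appL (renV ρ V) (rename ρ t)
renV ρ (esL V t)  = esL (renV (ext ρ) V) (rename ρ t)
renV ρ (appR t V) = appR (rename ρ t) (renV ρ V)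
renV ρ (esR t V)  = esR (rename (ext ρ) t) (renV ρ V)

data SCtx : ℕ → ℕ → Set where
  hole : ∀ {n} → SCtx n zero
  esL  : ∀ {n k} → SCtx (suc n) k → Tm n → SCtx n (suc k)

plugS : ∀ {n k} → SCtx n k → Tm (n ⊕ k) → Tm n
plugS hole      u = u
plugS (esL S t) u = es (plugS S u) t

data ECtx : ℕ → ℕ → Set where
  hole : ∀ {n} → ECtx n zero
  appL : ∀ {n k} → ECtx n k → Tm n → ECtx n k
  esL  : ∀ {n k} → ECtx (suc n) k → Tm n → ECtx n (suc k)
  esN  : ∀ {n j k} → ECtx (suc n) j → ECtx n k → ECtx n k   -- esN E E' = E⟨⟨x⟩⟩[x←E']

plugE : ∀ {n k} → ECtx n k → Tm (n ⊕ k) → Tm n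
plugE hole        u = u
plugE (appL E t)  u = app (plugE E u) t
plugE (esL E t)   u = es (plugE E u) t
plugE (esN {j = j} E E') u = es (plugE E (var (wkN j zero))) (plugE E' u)

renE : ∀ {n n' k} → Ren n n' → ECtx n k → ECtx n' k
renE ρ hole        = hole
renE ρ (appL E t)  = appL (renE ρ E) (rename ρ t)
renE ρ (esL E t)   = esL (renE (ext ρ) E) (rename ρ t)
renE ρ (esN E E')  = esN (renE (ext ρ) E) (renE ρ E')

-- Root steps.  The value v is lam b.
-- S⟨λx.b⟩ s ↦m S⟨b[x←s]⟩
data _↦m_ {n : ℕ} : Tm n → Tm n → Set where
  rule-m : ∀ {k} (S : SCtx n k) (b : Tm (suc (n ⊕ k))) (s : Tm n) →
    app (plugS S (lam b)) s ↦m plugS S (es b (rename (wkN k) s))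

-- V⟨⟨x⟩⟩[x←S⟨v⟩] ↦e,cbv S⟨V⟨⟨v⟩⟩[x←v]⟩
data _↦e-cbv_ {n : ℕ} : Tm n → Tm n → Set where
  rule-e : ∀ {j k} (V : VCtx (suc n) j) (S : SCtx n k) (b : Tm (suc (n ⊕ k))) →
    es (plugV V (var (wkN j zero))) (plugS S (lam b))
      ↦e-cbv plugS S (es (plugV (renV (ext (wkN k)) V) (rename (wkN (suc j)) (lam b))) (lam b))

-- E⟨⟨x⟩⟩[x←S⟨v⟩] ↦e,need S⟨E⟨⟨v⟩⟩[x←v]⟩
data _↦e-need_ {n : ℕ} : Tm n → Tm n → Set where
  rule-e : ∀ {j k} (E : ECtx (suc n) j) (S : SCtx n k) (b : Tm (suc (n ⊕ k))) →
    es (plugE E (var (wkN j zero))) (plugS S (lam b))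
      ↦e-need plugS S (es (plugE (renE (ext (wkN k)) E) (rename (wkN (suc j)) (lam b))) (lam b))

data _→m-cbv_ {n : ℕ} : Tm n → Tm n → Set where
  ctx : ∀ {k} (V : VCtx n k) {t s : Tm (n ⊕ k)} → t ↦m s → plugV V t →m-cbv plugV V s

data _→e-cbv_ {n : ℕ} : Tm n → Tm n → Set where
  ctx : ∀ {k} (V : VCtx n k) {t s : Tm (n ⊕ k)} → t ↦e-cbv s → plugV V t →e-cbv plugV V s

data _→m-need_ {n : ℕ} : Tm n → Tm n → Set where
  ctx : ∀ {k} (E : ECtx n k) {t s : Tm (n ⊕ k)} → t ↦m s → plugE E t →m-need plugE E s

data _→e-need_ {n : ℕ} : Tm n → Tm n → Set where
  ctx : ∀ {k} (E : ECtx n k) {t s : Tm (n ⊕ k)} → t ↦e-need s → plugE E t →e-need plugE E s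

-- Unions (a step is tagged as multiplicative (inj₁) or exponential (inj₂))
_→cbv_ : ∀ {n} → Tm n → Tm n → Set
t →cbv u = (t →m-cbv u) ⊎ (t →e-cbv u)

_→need_ : ∀ {n} → Tm n → Tm n → Set
t →need u = (t →m-need u) ⊎ (t →e-need u)

module _ {A : Set} {P Q : A → A → Set} where
  ∣_∣m : ∀ {a b} → Star (λ x y → P x y ⊎ Q x y) a b → ℕ
  ∣ ε ∣m           = zero
  ∣ inj₁ _ ◅ d ∣m  = suc ∣ d ∣m
  ∣ inj₂ _ ◅ d ∣m  = ∣ d ∣m

  ∣_∣e : ∀ {a b} → Star (λ x y → P x y ⊎ Q x y) a b → ℕ
  ∣ ε ∣e           = zero
  ∣ inj₁ _ ◅ d ∣e  = ∣ d ∣e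
  ∣ inj₂ _ ◅ d ∣e  = suc ∣ d ∣e

data normal {n : ℕ} : Tm n → Set where
  lam : (t : Tm (suc n)) → normal (lam t)
  es  : {t : Tm (suc n)} (s : Tm n) → normal t → normal (es t s)

data normal-cbv {n : ℕ} : Tm n → Set where
  lam : (t : Tm (suc n)) → normal-cbv (lam t)
  es  : {t : Tm (suc n)} {s : Tm n} → normal-cbv t → normal-cbv s → normal-cbv (es t s)

module Submission where

-- Both strategies are sub-relations of one "weak" step relation Step k
-- (k = mul | exp): distant β, and linear substitution of a value for one
-- occurrence of a variable, both closed under every context not under a λ.
-- The theorem follows by induction on |d|: follow CbNeed from t, closing each
-- CbNeed step against d by random descent, so each consumes one step of d.

open import Defs
open import Data.Nat using (ℕ; zero; suc; _+_; _≤_; _<_; z≤n; s≤s)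
open import Data.Nat.Properties using (+-suc; ≤-refl)
open import Data.Fin using (Fin; zero; suc)
open import Data.Fin.Properties using (suc-injective)
open import Data.Product using (Σ; _×_; _,_)
open import Data.Sum using (_⊎_; inj₁; inj₂)
import Data.Sum as Sum
open import Data.Empty using (⊥-elim)
open import Relation.Nullary using (¬_)
open import Relation.Binary.PropositionalEquality
open import Relation.Binary.Construct.Closure.ReflexiveTransitive using (Star; ε; _◅_)
import Relation.Binary.Construct.Closure.ReflexiveTransitive as Star

record SameCounts {A B : Set} {P Q : A → A → Set} {P' Q' : B → B → Set} {a b c d}
  (d₁ : Star (λ x y → P x y ⊎ Q x y) a b) (d₂ : Star (λ x y → P' x y ⊎ Q' x y) c d) : Set where
  constructor _,_
  field
    mul-eq : ∣ d₁ ∣m ≡ ∣ d₂ ∣m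
    exp-eq : ∣ d₁ ∣e ≡ ∣ d₂ ∣e
open SameCounts

counts-trans : ∀ {A B C : Set} {P Q : A → A → Set} {P' Q' : B → B → Set} {P'' Q'' : C → C → Set}
  {a b c d e f} {d₁ : Star (λ x y → P x y ⊎ Q x y) a b} {d₂ : Star (λ x y → P' x y ⊎ Q' x y) c d}
  {d₃ : Star (λ x y → P'' x y ⊎ Q'' x y) e f} →
  SameCounts d₁ d₂ → SameCounts d₂ d₃ → SameCounts d₁ d₃
counts-trans (m₁ , e₁) (m₂ , e₂) = trans m₁ m₂ , trans e₁ e₂

map-counts : ∀ {A : Set} {P Q P' Q' : A → A → Set}
  (f : ∀ {x y} → P x y → P' x y) (g : ∀ {x y} → Q x y → Q' x y) {a b}
  (d : Star (λ x y → P x y ⊎ Q x y) a b) → SameCounts (Star.map (Sum.map f g) d) d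
map-counts f g ε            = refl , refl
map-counts f g (inj₁ _ ◅ d) = cong suc (mul-eq (map-counts f g d)) , exp-eq (map-counts f g d)
map-counts f g (inj₂ _ ◅ d) = mul-eq (map-counts f g d) , cong suc (exp-eq (map-counts f g d))

cons-map-≤ : ∀ {A : Set} {P Q P' Q' : A → A → Set}
  (f : ∀ {x y} → P x y → P' x y) (g : ∀ {x y} → Q x y → Q' x y) {a b c c'}
  (x : P a b ⊎ Q a b) {d' : Star (λ x y → P x y ⊎ Q x y) b c}
  {d : Star (λ x y → P' x y ⊎ Q' x y) b c'} → ∣ d' ∣m ≤ ∣ d ∣m → ∣ d' ∣e ≤ ∣ d ∣e →
  (∣ x ◅ d' ∣m ≤ ∣ Sum.map f g x ◅ d ∣m) × (∣ x ◅ d' ∣e ≤ ∣ Sum.map f g x ◅ d ∣e)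
cons-map-≤ f g (inj₁ _) m≤ e≤ = s≤s m≤ , e≤
cons-map-≤ f g (inj₂ _) m≤ e≤ = m≤ , s≤s e≤

-- Abstract rewriting: random descent for kind-labelled diamond relations

data Kind : Set where
  mul exp : Kind

Joinable : ∀ {A : Set} → (Kind → A → A → Set) → Kind → A → Kind → A → Set
Joinable {A} R k₁ t₁ k₂ t₂ = (k₁ ≡ k₂ × t₁ ≡ t₂) ⊎ Σ A (λ t₃ → R k₂ t₁ t₃ × R k₁ t₂ t₃)

Diamond : ∀ {A : Set} → (Kind → A → A → Set) → Set
Diamond R = ∀ {k₁ k₂ t t₁ t₂} → R k₁ t t₁ → R k₂ t t₂ → Joinable R k₁ t₁ k₂ t₂

Joinable-map : ∀ {A B : Set} {R : Kind → A → A → Set} {R' : Kind → B → B → Set}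
  (C : A → B) (f : ∀ {k a b} → R k a b → R' k (C a) (C b)) {k₁ k₂ t₁ t₂} →
  Joinable R k₁ t₁ k₂ t₂ → Joinable R' k₁ (C t₁) k₂ (C t₂)
Joinable-map C f (inj₁ (refl , refl))  = inj₁ (refl , refl)
Joinable-map C f (inj₂ (t₃ , p , q)) = inj₂ (C t₃ , f p , f q)

module RandomDescent {A : Set} (R : Kind → A → A → Set) (diamond : Diamond R) where

  Steps : A → A → Set
  Steps = Star (λ x y → R mul x y ⊎ R exp x y)

  Normal : A → Set
  Normal t = ∀ {k t'} → ¬ R k t t'

  tag : ∀ {k x y} → R k x y → R mul x y ⊎ R exp x y
  tag {mul} p = inj₁ p
  tag {exp} p = inj₂ p

  counts-cons : ∀ {k a b a' b' c c'} (p : R k a b) (q : R k a' b')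
    {d : Steps b c} {d' : Steps b' c'} → SameCounts d d' → SameCounts (tag p ◅ d) (tag q ◅ d')
  counts-cons {mul} p q (m , e) = cong suc m , e
  counts-cons {exp} p q (m , e) = m , cong suc e

  counts-square : ∀ {k₁ k₂ t t₁ t₂ t₃ u} (p : R k₁ t t₁) (a : R k₂ t₁ t₃)
    (q : R k₂ t t₂) (b : R k₁ t₂ t₃) (d : Steps t₃ u) →
    SameCounts (tag p ◅ tag a ◅ d) (tag q ◅ tag b ◅ d)
  counts-square {mul} {mul} p a q b d = refl , refl
  counts-square {mul} {exp} p a q b d = refl , refl
  counts-square {exp} {mul} p a q b d = refl , refl
  counts-square {exp} {exp} p a q b d = refl , refl

  mutual
    descent : ∀ {k t t₁ u} (d : Steps t u) → Normal u → (p : R k t t₁) →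
      Σ (Steps t₁ u) λ d₁ → SameCounts (tag p ◅ d₁) d
    descent ε            nu p = ⊥-elim (nu p)
    descent (inj₁ q ◅ d) nu p = close-square p q d nu
    descent (inj₂ q ◅ d) nu p = close-square p q d nu

    -- Close p against the first step q of d; if they differ, recurse into
    -- the rest of d from the far corner of their diamond square.
    close-square : ∀ {k₁ k₂ t t₁ t₂ u} (p : R k₁ t t₁) (q : R k₂ t t₂) (d : Steps t₂ u) →
      Normal u → Σ (Steps t₁ u) λ d₁ → SameCounts (tag p ◅ d₁) (tag q ◅ d)
    close-square p q d nu with diamond p q
    ... | inj₁ (refl , refl) = d , counts-cons p q (refl , refl)
    ... | inj₂ (t₃ , a , b) with descent d nu b
    ...   | d₃ , same = tag a ◅ d₃ , counts-trans (counts-square p a q b d₃) (counts-cons q q same)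

  descent⁺ : ∀ {t t₁ u} (d : Steps t u) → Normal u → (p : R mul t t₁ ⊎ R exp t t₁) →
    Σ (Steps t₁ u) λ d₁ → SameCounts (p ◅ d₁) d
  descent⁺ d nu (inj₁ p) = descent d nu p
  descent⁺ d nu (inj₂ p) = descent d nu p

ext-cong : ∀ {n m} {ρ σ : Ren n m} → (∀ i → ρ i ≡ σ i) → ∀ i → ext ρ i ≡ ext σ i
ext-cong h zero    = refl
ext-cong h (suc i) = cong suc (h i)

rename-cong : ∀ {n m} {ρ σ : Ren n m} → (∀ i → ρ i ≡ σ i) → ∀ t → rename ρ t ≡ rename σ t
rename-cong h (var i)   = cong var (h i)
rename-cong h (lam t)   = cong lam (rename-cong (ext-cong h) t)
rename-cong h (app t s) = cong₂ app (rename-cong h t) (rename-cong h s)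
rename-cong h (es t s)  = cong₂ es (rename-cong (ext-cong h) t) (rename-cong h s)

ext-∘ : ∀ {n m k} (ρ : Ren m k) (σ : Ren n m) → ∀ i → ext ρ (ext σ i) ≡ ext (λ x → ρ (σ x)) i
ext-∘ ρ σ zero    = refl
ext-∘ ρ σ (suc i) = refl

rename-∘ : ∀ {n m k} (ρ : Ren m k) (σ : Ren n m) t →
  rename ρ (rename σ t) ≡ rename (λ x → ρ (σ x)) t
rename-∘ ρ σ (var i)   = refl
rename-∘ ρ σ (lam t)   = cong lam (trans (rename-∘ (ext ρ) (ext σ) t) (rename-cong (ext-∘ ρ σ) t))
rename-∘ ρ σ (app t s) = cong₂ app (rename-∘ ρ σ t) (rename-∘ ρ σ s)
rename-∘ ρ σ (es t s)  =
  cong₂ es (trans (rename-∘ (ext ρ) (ext σ) t) (rename-cong (ext-∘ ρ σ) t)) (rename-∘ ρ σ s)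

ext-id : ∀ {n} {ρ : Ren n n} → (∀ i → ρ i ≡ i) → ∀ i → ext ρ i ≡ i
ext-id h zero    = refl
ext-id h (suc i) = cong suc (h i)

rename-id : ∀ {n} {ρ : Ren n n} → (∀ i → ρ i ≡ i) → ∀ t → rename ρ t ≡ t
rename-id h (var i)   = cong var (h i)
rename-id h (lam t)   = cong lam (rename-id (ext-id h) t)
rename-id h (app t s) = cong₂ app (rename-id h t) (rename-id h s)
rename-id h (es t s)  = cong₂ es (rename-id (ext-id h) t) (rename-id h s)

rename-square : ∀ {n m₁ m₂ k} {ρ₁ : Ren m₁ k} {σ₁ : Ren n m₁} {σ₂ : Ren m₂ k} {ρ₂ : Ren n m₂} →
  (∀ i → ρ₁ (σ₁ i) ≡ σ₂ (ρ₂ i)) → ∀ t → rename ρ₁ (rename σ₁ t) ≡ rename σ₂ (rename ρ₂ t)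
rename-square {ρ₁ = ρ₁} {σ₁} {σ₂} {ρ₂} h t =
  trans (rename-∘ ρ₁ σ₁ t) (trans (rename-cong h t) (sym (rename-∘ σ₂ ρ₂ t)))

rename-weaken : ∀ {n m} (ρ : Ren n m) t → rename (ext ρ) (rename suc t) ≡ rename suc (rename ρ t)
rename-weaken ρ = rename-square (λ i → refl)

rename-ext-weaken : ∀ {n m} (ρ : Ren n m) t →
  rename (ext (ext ρ)) (rename (ext suc) t) ≡ rename (ext suc) (rename (ext ρ) t)
rename-ext-weaken ρ = rename-square λ { zero → refl ; (suc i) → refl }

wkN-weaken : ∀ {n} j (t : Tm n) → rename (wkN j) (rename suc t) ≡ rename (wkN (suc j)) t
wkN-weaken j = rename-∘ (wkN j) suc

renV-cong : ∀ {n m k} {ρ σ : Ren n m} → (∀ i → ρ i ≡ σ i) → (V : VCtx n k) → renV ρ V ≡ renV σ V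
renV-cong h hole       = refl
renV-cong h (appL V t) = cong₂ appL (renV-cong h V) (rename-cong h t)
renV-cong h (esL V t)  = cong₂ esL (renV-cong (ext-cong h) V) (rename-cong h t)
renV-cong h (appR t V) = cong₂ appR (rename-cong h t) (renV-cong h V)
renV-cong h (esR t V)  = cong₂ esR (rename-cong (ext-cong h) t) (renV-cong h V)

renV-∘ : ∀ {n m k j} (ρ : Ren m k) (σ : Ren n m) (V : VCtx n j) →
  renV ρ (renV σ V) ≡ renV (λ x → ρ (σ x)) V
renV-∘ ρ σ hole       = refl
renV-∘ ρ σ (appL V t) = cong₂ appL (renV-∘ ρ σ V) (rename-∘ ρ σ t)
renV-∘ ρ σ (esL V t)  =
  cong₂ esL (trans (renV-∘ (ext ρ) (ext σ) V) (renV-cong (ext-∘ ρ σ) V)) (rename-∘ ρ σ t)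
renV-∘ ρ σ (appR t V) = cong₂ appR (rename-∘ ρ σ t) (renV-∘ ρ σ V)
renV-∘ ρ σ (esR t V)  =
  cong₂ esR (trans (rename-∘ (ext ρ) (ext σ) t) (rename-cong (ext-∘ ρ σ) t)) (renV-∘ ρ σ V)

renV-id : ∀ {n k} {ρ : Ren n n} → (∀ i → ρ i ≡ i) → (V : VCtx n k) → renV ρ V ≡ V
renV-id h hole       = refl
renV-id h (appL V t) = cong₂ appL (renV-id h V) (rename-id h t)
renV-id h (esL V t)  = cong₂ esL (renV-id (ext-id h) V) (rename-id h t)
renV-id h (appR t V) = cong₂ appR (rename-id h t) (renV-id h V)
renV-id h (esR t V)  = cong₂ esR (rename-id (ext-id h) t) (renV-id h V)

extN : ∀ {n m} j → Ren n m → Ren (n ⊕ j) (m ⊕ j)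
extN zero    ρ = ρ
extN (suc j) ρ = extN j (ext ρ)

extN-wkN : ∀ {n m} j (ρ : Ren n m) i → extN j ρ (wkN j i) ≡ wkN j (ρ i)
extN-wkN zero    ρ i = refl
extN-wkN (suc j) ρ i = extN-wkN j (ext ρ) (suc i)

rename-plugV : ∀ {n m j} (ρ : Ren n m) (V : VCtx n j) u →
  rename ρ (plugV V u) ≡ plugV (renV ρ V) (rename (extN j ρ) u)
rename-plugV ρ hole       u = refl
rename-plugV ρ (appL V t) u = cong (λ x → app x (rename ρ t)) (rename-plugV ρ V u)
rename-plugV ρ (esL V t)  u = cong (λ x → es x (rename ρ t)) (rename-plugV (ext ρ) V u)
rename-plugV ρ (appR t V) u = cong (app (rename ρ t)) (rename-plugV ρ V u)
rename-plugV ρ (esR t V)  u = cong (es (rename (ext ρ) t)) (rename-plugV ρ V u)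

rename-plugV-var : ∀ {n m j} (ρ : Ren n m) (V : VCtx n j) i →
  rename ρ (plugV V (var (wkN j i))) ≡ plugV (renV ρ V) (var (wkN j (ρ i)))
rename-plugV-var {j = j} ρ V i =
  trans (rename-plugV ρ V _) (cong (λ x → plugV (renV ρ V) (var x)) (extN-wkN j ρ i))

-- The weak step relation

-- Replace i w t t': t' is t with one occurrence of the variable i in weak
-- position (not under a λ) replaced by w.
data Replace : ∀ {n} → Fin n → Tm n → Tm n → Tm n → Set where
  here : ∀ {n} {i : Fin n} {w} → Replace i w (var i) w
  appL : ∀ {n} {i : Fin n} {w t t' s} → Replace i w t t' → Replace i w (app t s) (app t' s)
  appR : ∀ {n} {i : Fin n} {w t s s'} → Replace i w s s' → Replace i w (app t s) (app t s')
  esL  : ∀ {n} {i : Fin n} {w t t' s} →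
         Replace (suc i) (rename suc w) t t' → Replace i w (es t s) (es t' s)
  esR  : ∀ {n} {i : Fin n} {w t s s'} → Replace i w s s' → Replace i w (es t s) (es t s')

-- MulStep a s r: app a s is a distant β-redex with contractum r, i.e.
-- a = S⟨λx.b⟩ and r = S⟨b[x←s]⟩.
data MulStep : ∀ {n} → Tm n → Tm n → Tm n → Set where
  root : ∀ {n} (b : Tm (suc n)) s → MulStep (lam b) s (es b s)
  push : ∀ {n} {a : Tm (suc n)} {s r u} →
         MulStep a (rename suc s) r → MulStep (es a u) s (es r u)

-- ExpStep t a r: t[x←a] is a linear-substitution redex with contractum r,
-- i.e. a = S⟨v⟩ and r = S⟨t'[x←v]⟩ where t' replaces one weak occurrence of x in t by v.
data ExpStep : ∀ {n} → Tm (suc n) → Tm n → Tm n → Set where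
  root : ∀ {n} {t t' : Tm (suc n)} {b} →
         Replace zero (rename suc (lam b)) t t' → ExpStep t (lam b) (es t' (lam b))
  push : ∀ {n} {t : Tm (suc n)} {a r u} →
         ExpStep (rename (ext suc) t) a r → ExpStep t (es a u) (es r u)

data Step : ∀ {n} → Kind → Tm n → Tm n → Set where
  rootM : ∀ {n} {a s r : Tm n} → MulStep a s r → Step mul (app a s) r
  rootE : ∀ {n} {t : Tm (suc n)} {a r} → ExpStep t a r → Step exp (es t a) r
  appL  : ∀ {n k} {t t' s : Tm n} → Step k t t' → Step k (app t s) (app t' s)
  appR  : ∀ {n k} {t s s' : Tm n} → Step k s s' → Step k (app t s) (app t s')
  esL   : ∀ {n k} {t t' : Tm (suc n)} {s} → Step k t t' → Step k (es t s) (es t' s)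
  esR   : ∀ {n k} {t : Tm (suc n)} {s s'} → Step k s s' → Step k (es t s) (es t s')

Step⁺ : ∀ {n} → Tm n → Tm n → Set
Step⁺ t u = Step mul t u ⊎ Step exp t u

plugV-replace : ∀ {n j} (V : VCtx n j) (i : Fin n) w →
  Replace i w (plugV V (var (wkN j i))) (plugV V (rename (wkN j) w))
plugV-replace hole       i w = subst (Replace i w (var i)) (sym (rename-id (λ _ → refl) w)) here
plugV-replace (appL V t) i w = appL (plugV-replace V i w)
plugV-replace {j = suc j} (esL V t) i w =
  esL (subst (Replace (suc i) (rename suc w) _) (cong (plugV V) (wkN-weaken j w))
             (plugV-replace V (suc i) (rename suc w)))
plugV-replace (appR t V) i w = appR (plugV-replace V i w)
plugV-replace (esR t V)  i w = esR (plugV-replace V i w)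

↦m-mulStep : ∀ {n k} (S : SCtx n k) b s →
  MulStep (plugS S (lam b)) s (plugS S (es b (rename (wkN k) s)))
↦m-mulStep hole b s = subst (MulStep (lam b) s) (cong (es b) (sym (rename-id (λ _ → refl) s))) (root b s)
↦m-mulStep {k = suc k} (esL S u) b s =
  push (subst (MulStep (plugS S (lam b)) (rename suc s)) (cong (λ x → plugS S (es b x)) (wkN-weaken k s))
              (↦m-mulStep S b (rename suc s)))

↦e-cbv-expStep : ∀ {n j k} (V : VCtx (suc n) j) (S : SCtx n k) b →
  ExpStep (plugV V (var (wkN j zero))) (plugS S (lam b))
          (plugS S (es (plugV (renV (ext (wkN k)) V) (rename (wkN (suc j)) (lam b))) (lam b)))
↦e-cbv-expStep {j = j} V hole b =
  root (subst (Replace zero (rename suc (lam b)) (plugV V (var (wkN j zero))))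
              (cong₂ plugV (sym (renV-id (ext-id (λ _ → refl)) V)) (wkN-weaken j (lam b)))
              (plugV-replace V zero (rename suc (lam b))))
↦e-cbv-expStep {j = j} {k = suc k} V (esL S u) b =
  push (subst₂ (λ x y → ExpStep x (plugS S (lam b)) (plugS S (es (plugV y (rename (wkN (suc j)) (lam b))) (lam b))))
               (sym (rename-plugV-var (ext suc) V zero)) fuse
               (↦e-cbv-expStep (renV (ext suc) V) S b))
  where
  fuse : renV (ext (wkN k)) (renV (ext suc) V) ≡ renV (ext (wkN (suc k))) V
  fuse = trans (renV-∘ (ext (wkN k)) (ext suc) V) (renV-cong (ext-∘ (wkN k) suc) V)

Step-plugV : ∀ {n j k} (V : VCtx n j) {t t'} → Step k t t' → Step k (plugV V t) (plugV V t')
Step-plugV hole       st = st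
Step-plugV (appL V x) st = appL (Step-plugV V st)
Step-plugV (esL V x)  st = esL (Step-plugV V st)
Step-plugV (appR x V) st = appR (Step-plugV V st)
Step-plugV (esR x V)  st = esR (Step-plugV V st)

Step-plugE : ∀ {n j k} (E : ECtx n j) {t t'} → Step k t t' → Step k (plugE E t) (plugE E t')
Step-plugE hole        st = st
Step-plugE (appL E x)  st = appL (Step-plugE E st)
Step-plugE (esL E x)   st = esL (Step-plugE E st)
Step-plugE (esN E E')  st = esR (Step-plugE E' st)

cbv-mul-step : ∀ {n} {t u : Tm n} → t →m-cbv u → Step mul t u
cbv-mul-step (ctx V (rule-m S b s)) = Step-plugV V (rootM (↦m-mulStep S b s))

cbv-exp-step : ∀ {n} {t u : Tm n} → t →e-cbv u → Step exp t u
cbv-exp-step (ctx V (rule-e V' S b)) = Step-plugV V (rootE (↦e-cbv-expStep V' S b))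

E→V : ∀ {n j} → ECtx n j → VCtx n j
E→V hole               = hole
E→V (appL E t)         = appL (E→V E) t
E→V (esL E t)          = esL (E→V E) t
E→V (esN {j = j} E E') = esR (plugE E (var (wkN j zero))) (E→V E')

plugE-plugV : ∀ {n j} (E : ECtx n j) u → plugE E u ≡ plugV (E→V E) u
plugE-plugV hole       u = refl
plugE-plugV (appL E t) u = cong (λ x → app x t) (plugE-plugV E u)
plugE-plugV (esL E t)  u = cong (λ x → es x t) (plugE-plugV E u)
plugE-plugV (esN E E') u = cong (es _) (plugE-plugV E' u)

E→V-renE : ∀ {n m j} (ρ : Ren n m) (E : ECtx n j) → E→V (renE ρ E) ≡ renV ρ (E→V E)
E→V-renE ρ hole       = refl
E→V-renE ρ (appL E t) = cong (λ x → appL x (rename ρ t)) (E→V-renE ρ E)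
E→V-renE ρ (esL E t)  = cong (λ x → esL x (rename ρ t)) (E→V-renE (ext ρ) E)
E→V-renE ρ (esN {j = j} E E') = cong₂ esR (sym rename-hole) (E→V-renE ρ E')
  where
  open ≡-Reasoning
  rename-hole : rename (ext ρ) (plugE E (var (wkN j zero))) ≡ plugE (renE (ext ρ) E) (var (wkN j zero))
  rename-hole = begin
    rename (ext ρ) (plugE E (var (wkN j zero)))          ≡⟨ cong (rename (ext ρ)) (plugE-plugV E _) ⟩
    rename (ext ρ) (plugV (E→V E) (var (wkN j zero)))    ≡⟨ rename-plugV-var (ext ρ) (E→V E) zero ⟩
    plugV (renV (ext ρ) (E→V E)) (var (wkN j zero))      ≡⟨ cong (λ V → plugV V _) (sym (E→V-renE (ext ρ) E)) ⟩
    plugV (E→V (renE (ext ρ) E)) (var (wkN j zero))      ≡⟨ sym (plugE-plugV (renE (ext ρ) E) _) ⟩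
    plugE (renE (ext ρ) E) (var (wkN j zero))            ∎

-- The root rule ↦e,need is the ↦e,cbv instance for the weak context E→V E.
↦e-need-step : ∀ {n} {t u : Tm n} → t ↦e-need u → Step exp t u
↦e-need-step (rule-e {k = k} E S b) =
  subst₂ (Step exp) (cong (λ x → es x (plugS S (lam b))) (sym (plugE-plugV E _)))
    (cong (λ y → plugS S (es y (lam b)))
          (sym (trans (plugE-plugV (renE (ext (wkN k)) E) _)
                      (cong (λ V → plugV V _) (E→V-renE (ext (wkN k)) E)))))
    (rootE (↦e-cbv-expStep (E→V E) S b))

need-mul-step : ∀ {n} {t u : Tm n} → t →m-need u → Step mul t u
need-mul-step (ctx E (rule-m S b s)) = Step-plugE E (rootM (↦m-mulStep S b s))

need-exp-step : ∀ {n} {t u : Tm n} → t →e-need u → Step exp t u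
need-exp-step (ctx E r) = Step-plugE E (↦e-need-step r)

Replace-rename : ∀ {n m} (ρ : Ren n m) {i w t t'} → Replace i w t t' →
  Replace (ρ i) (rename ρ w) (rename ρ t) (rename ρ t')
Replace-rename ρ here     = here
Replace-rename ρ (appL x) = appL (Replace-rename ρ x)
Replace-rename ρ (appR x) = appR (Replace-rename ρ x)
Replace-rename ρ {w = w} (esL x) =
  esL (subst (λ y → Replace _ y _ _) (rename-weaken ρ w) (Replace-rename (ext ρ) x))
Replace-rename ρ (esR x)  = esR (Replace-rename ρ x)

MulStep-rename : ∀ {n m} (ρ : Ren n m) {a s r} → MulStep a s r →
  MulStep (rename ρ a) (rename ρ s) (rename ρ r)
MulStep-rename ρ (root b s) = root _ _
MulStep-rename ρ {s = s} (push x) =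
  push (subst (λ y → MulStep _ y _) (rename-weaken ρ s) (MulStep-rename (ext ρ) x))

ExpStep-rename : ∀ {n m} (ρ : Ren n m) {t a r} → ExpStep t a r →
  ExpStep (rename (ext ρ) t) (rename ρ a) (rename ρ r)
ExpStep-rename ρ {t = t} {a = lam b} (root {t' = t'} x) =
  root (subst (λ y → Replace zero y (rename (ext ρ) t) (rename (ext ρ) t'))
              (rename-weaken ρ (lam b)) (Replace-rename (ext ρ) x))
ExpStep-rename ρ {t = t} (push x) =
  push (subst (λ y → ExpStep y _ _) (rename-ext-weaken ρ t) (ExpStep-rename (ext ρ) x))

Step-rename : ∀ {n m k} (ρ : Ren n m) {t t'} → Step k t t' → Step k (rename ρ t) (rename ρ t')
Step-rename ρ (rootM x) = rootM (MulStep-rename ρ x)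
Step-rename ρ (rootE x) = rootE (ExpStep-rename ρ x)
Step-rename ρ (appL x)  = appL (Step-rename ρ x)
Step-rename ρ (appR x)  = appR (Step-rename ρ x)
Step-rename ρ (esL x)   = esL (Step-rename (ext ρ) x)
Step-rename ρ (esR x)   = esR (Step-rename ρ x)

-- The diamond property of weak steps, by cases on pairs of redexes

Replace-commute : ∀ {n} {i j : Fin n} {w v t t₁ t₂} → Replace i w t t₁ → Replace j v t t₂ → i ≢ j →
  Σ (Tm n) λ t₃ → Replace j v t₁ t₃ × Replace i w t₂ t₃
Replace-commute here here i≢j = ⊥-elim (i≢j refl)
Replace-commute (appL a) (appL b) i≢j with Replace-commute a b i≢j
... | _ , x , y = _ , appL x , appL y
Replace-commute (appL a) (appR b) i≢j = _ , appR b , appL a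
Replace-commute (appR a) (appL b) i≢j = _ , appL b , appR a
Replace-commute (appR a) (appR b) i≢j with Replace-commute a b i≢j
... | _ , x , y = _ , appR x , appR y
Replace-commute (esL a) (esL b) i≢j with Replace-commute a b (λ e → i≢j (suc-injective e))
... | _ , x , y = _ , esL x , esL y
Replace-commute (esL a) (esR b) i≢j = _ , esR b , esL a
Replace-commute (esR a) (esL b) i≢j = _ , esL b , esR a
Replace-commute (esR a) (esR b) i≢j with Replace-commute a b i≢j
... | _ , x , y = _ , esR x , esR y

Replace-same : ∀ {n} {i : Fin n} {w t t₁ t₂} → Replace i w t t₁ → Replace i w t t₂ →
  (t₁ ≡ t₂) ⊎ (Σ (Tm n) λ t₃ → Replace i w t₁ t₃ × Replace i w t₂ t₃)
Replace-same here here = inj₁ refl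
Replace-same (appL a) (appL b) with Replace-same a b
... | inj₁ refl            = inj₁ refl
... | inj₂ (_ , x , y)     = inj₂ (_ , appL x , appL y)
Replace-same (appL a) (appR b) = inj₂ (_ , appR b , appL a)
Replace-same (appR a) (appL b) = inj₂ (_ , appL b , appR a)
Replace-same (appR a) (appR b) with Replace-same a b
... | inj₁ refl            = inj₁ refl
... | inj₂ (_ , x , y)     = inj₂ (_ , appR x , appR y)
Replace-same (esL a) (esL b) with Replace-same a b
... | inj₁ refl            = inj₁ refl
... | inj₂ (_ , x , y)     = inj₂ (_ , esL x , esL y)
Replace-same (esL a) (esR b) = inj₂ (_ , esR b , esL a)
Replace-same (esR a) (esL b) = inj₂ (_ , esL b , esR a)
Replace-same (esR a) (esR b) with Replace-same a b
... | inj₁ refl            = inj₁ refl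
... | inj₂ (_ , x , y)     = inj₂ (_ , esR x , esR y)

MulStep-replace-fun : ∀ {n} {i : Fin n} {w a a' s r} → MulStep a s r → Replace i w a a' →
  Σ (Tm n) λ r' → MulStep a' s r' × Replace i w r r'
MulStep-replace-fun (root b s) ()
MulStep-replace-fun (push m) (esL x) with MulStep-replace-fun m x
... | _ , m' , x' = _ , push m' , esL x'
MulStep-replace-fun (push m) (esR x) = _ , push m , esR x

MulStep-replace-arg : ∀ {n} {i : Fin n} {w a s s' r} → MulStep a s r → Replace i w s s' →
  Σ (Tm n) λ r' → MulStep a s' r' × Replace i w r r'
MulStep-replace-arg (root b s) x = _ , root b _ , esR x
MulStep-replace-arg (push m) x with MulStep-replace-arg m (Replace-rename suc x)
... | _ , m' , x' = _ , push m' , esL x'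

ExpStep-replace-body : ∀ {n} {i : Fin n} {w t t' a r} → ExpStep t a r →
  Replace (suc i) (rename suc w) t t' → Σ (Tm n) λ r' → ExpStep t' a r' × Replace i w r r'
ExpStep-replace-body (root x) y with Replace-commute x y (λ ())
... | _ , p , q = _ , root q , esL p
ExpStep-replace-body {w = w} (push e) y
  with ExpStep-replace-body e (subst (λ z → Replace _ z _ _) (rename-weaken suc w) (Replace-rename (ext suc) y))
... | _ , e' , x' = _ , push e' , esL x'

ExpStep-replace-arg : ∀ {n} {i : Fin n} {w t a a' r} → ExpStep t a r → Replace i w a a' →
  Σ (Tm n) λ r' → ExpStep t a' r' × Replace i w r r'
ExpStep-replace-arg (root x) ()
ExpStep-replace-arg (push e) (esL y) with ExpStep-replace-arg e y
... | _ , e' , x' = _ , push e' , esL x'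
ExpStep-replace-arg (push e) (esR y) = _ , push e , esR y

Replace-Step : ∀ {n k} {i : Fin n} {w t t' t₂} → Replace i w t t' → Step k t t₂ →
  Σ (Tm n) λ t₃ → Replace i w t₂ t₃ × Step k t' t₃
Replace-Step here ()
Replace-Step (appL x) (rootM m) with MulStep-replace-fun m x
... | _ , m' , x' = _ , x' , rootM m'
Replace-Step (appR x) (rootM m) with MulStep-replace-arg m x
... | _ , m' , x' = _ , x' , rootM m'
Replace-Step (esL x) (rootE e) with ExpStep-replace-body e x
... | _ , e' , x' = _ , x' , rootE e'
Replace-Step (esR x) (rootE e) with ExpStep-replace-arg e x
... | _ , e' , x' = _ , x' , rootE e'
Replace-Step (appL x) (appL st) with Replace-Step x st
... | _ , p , q = _ , appL p , appL q
Replace-Step (appL x) (appR st) = _ , appL x , appR st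
Replace-Step (appR x) (appL st) = _ , appR x , appL st
Replace-Step (appR x) (appR st) with Replace-Step x st
... | _ , p , q = _ , appR p , appR q
Replace-Step (esL x) (esL st) with Replace-Step x st
... | _ , p , q = _ , esL p , esL q
Replace-Step (esL x) (esR st) = _ , esL x , esR st
Replace-Step (esR x) (esL st) = _ , esR x , esL st
Replace-Step (esR x) (esR st) with Replace-Step x st
... | _ , p , q = _ , esR p , esR q

MulStep-ExpStep : ∀ {n} {a₀ : Tm (suc n)} {s u a' r₀} → MulStep a₀ (rename suc s) r₀ → ExpStep a₀ u a' →
  Σ (Tm n) λ r' → MulStep a' s r' × ExpStep r₀ u r'
MulStep-ExpStep m (root x) with MulStep-replace-fun m x
... | _ , m' , x' = _ , push m' , root x'
MulStep-ExpStep {s = s} m (push e)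
  with MulStep-ExpStep (subst (λ y → MulStep _ y _) (rename-weaken suc s) (MulStep-rename (ext suc) m)) e
... | _ , m' , e' = _ , push m' , push e'

MulStep-fun : ∀ {n k} {a a' s r : Tm n} → MulStep a s r → Step k a a' →
  Σ (Tm n) λ r' → MulStep a' s r' × Step k r r'
MulStep-fun (root b s) ()
MulStep-fun (push m) (esL st) with MulStep-fun m st
... | _ , m' , st' = _ , push m' , esL st'
MulStep-fun (push m) (esR st) = _ , push m , esR st
MulStep-fun (push m) (rootE e) with MulStep-ExpStep m e
... | _ , m' , e' = _ , m' , rootE e'

MulStep-arg : ∀ {n k} {a s s' r : Tm n} → MulStep a s r → Step k s s' →
  Σ (Tm n) λ r' → MulStep a s' r' × Step k r r'
MulStep-arg (root b s) st = _ , root b _ , esR st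
MulStep-arg (push m) st with MulStep-arg m (Step-rename suc st)
... | _ , m' , st' = _ , push m' , esL st'

ExpStep-body : ∀ {n k} {t t' : Tm (suc n)} {a r} → ExpStep t a r → Step k t t' →
  Σ (Tm n) λ r' → ExpStep t' a r' × Step k r r'
ExpStep-body (root w) st with Replace-Step w st
... | _ , w' , st' = _ , root w' , esL st'
ExpStep-body (push e) st with ExpStep-body e (Step-rename (ext suc) st)
... | _ , e' , st' = _ , push e' , esL st'

ExpStep-ExpStep : ∀ {n} {t : Tm (suc n)} {a₁ r₁ u a'} → ExpStep (rename (ext suc) t) a₁ r₁ →
  ExpStep a₁ u a' → Σ (Tm n) λ r' → ExpStep t a' r' × ExpStep r₁ u r'
ExpStep-ExpStep e (root w) with ExpStep-replace-arg e w
... | _ , e' , w' = _ , push e' , root w'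
ExpStep-ExpStep {t = t} e (push e₂)
  with ExpStep-ExpStep (subst (λ y → ExpStep y _ _) (rename-ext-weaken suc t) (ExpStep-rename (ext suc) e)) e₂
... | _ , e' , e'' = _ , push e' , push e''

ExpStep-arg : ∀ {n k} {t : Tm (suc n)} {a a' r} → ExpStep t a r → Step k a a' →
  Σ (Tm n) λ r' → ExpStep t a' r' × Step k r r'
ExpStep-arg (root w) ()
ExpStep-arg (push e) (esL st) with ExpStep-arg e st
... | _ , e' , st' = _ , push e' , esL st'
ExpStep-arg (push e) (esR st) = _ , push e , esR st
ExpStep-arg (push e) (rootE e₂) with ExpStep-ExpStep e e₂
... | _ , e' , e'' = _ , e' , rootE e''

ExpStep-same : ∀ {n} {t : Tm (suc n)} {a r₁ r₂} → ExpStep t a r₁ → ExpStep t a r₂ →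
  (r₁ ≡ r₂) ⊎ Σ (Tm n) (λ r₃ → Step exp r₁ r₃ × Step exp r₂ r₃)
ExpStep-same (root w₁) (root w₂) with Replace-same w₁ w₂
... | inj₁ refl          = inj₁ refl
... | inj₂ (_ , x , y)   = inj₂ (_ , rootE (root x) , rootE (root y))
ExpStep-same (push e₁) (push e₂) with ExpStep-same e₁ e₂
... | inj₁ refl          = inj₁ refl
... | inj₂ (_ , x , y)   = inj₂ (_ , esL x , esL y)

MulStep-deterministic : ∀ {n} {a s r₁ r₂ : Tm n} → MulStep a s r₁ → MulStep a s r₂ → r₁ ≡ r₂
MulStep-deterministic (root b s) (root .b .s) = refl
MulStep-deterministic (push m₁) (push m₂) = cong (λ x → es x _) (MulStep-deterministic m₁ m₂)

Step-diamond : ∀ {n} → Diamond (Step {n})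
Step-diamond (rootM m₁) (rootM m₂) = inj₁ (refl , MulStep-deterministic m₁ m₂)
Step-diamond (rootM m) (appL st) with MulStep-fun m st
... | _ , m' , st' = inj₂ (_ , st' , rootM m')
Step-diamond (rootM m) (appR st) with MulStep-arg m st
... | _ , m' , st' = inj₂ (_ , st' , rootM m')
Step-diamond (appL st) (rootM m) with MulStep-fun m st
... | _ , m' , st' = inj₂ (_ , rootM m' , st')
Step-diamond (appR st) (rootM m) with MulStep-arg m st
... | _ , m' , st' = inj₂ (_ , rootM m' , st')
Step-diamond (rootE e₁) (rootE e₂) with ExpStep-same e₁ e₂
... | inj₁ eq = inj₁ (refl , eq)
... | inj₂ j  = inj₂ j
Step-diamond (rootE e) (esL st) with ExpStep-body e st
... | _ , e' , st' = inj₂ (_ , st' , rootE e')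
Step-diamond (rootE e) (esR st) with ExpStep-arg e st
... | _ , e' , st' = inj₂ (_ , st' , rootE e')
Step-diamond (esL st) (rootE e) with ExpStep-body e st
... | _ , e' , st' = inj₂ (_ , rootE e' , st')
Step-diamond (esR st) (rootE e) with ExpStep-arg e st
... | _ , e' , st' = inj₂ (_ , rootE e' , st')
Step-diamond (appL a) (appL b) = Joinable-map {R = Step} {R' = Step} (λ x → app x _) appL (Step-diamond a b)
Step-diamond (appL a) (appR b) = inj₂ (_ , appR b , appL a)
Step-diamond (appR a) (appL b) = inj₂ (_ , appL b , appR a)
Step-diamond (appR a) (appR b) = Joinable-map {R = Step} {R' = Step} (app _) appR (Step-diamond a b)
Step-diamond (esL a) (esL b)   = Joinable-map {R = Step} {R' = Step} (λ x → es x _) esL (Step-diamond a b)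
Step-diamond (esL a) (esR b)   = inj₂ (_ , esR b , esL a)
Step-diamond (esR a) (esL b)   = inj₂ (_ , esL b , esR a)
Step-diamond (esR a) (esR b)   = Joinable-map {R = Step} {R' = Step} (es _) esR (Step-diamond a b)

normal-cbv-no-Replace : ∀ {n} {i : Fin n} {w t t'} → normal-cbv t → ¬ Replace i w t t'
normal-cbv-no-Replace (es a b) (esL x) = normal-cbv-no-Replace a x
normal-cbv-no-Replace (es a b) (esR x) = normal-cbv-no-Replace b x

normal-cbv-rename : ∀ {n m} (ρ : Ren n m) {t} → normal-cbv t → normal-cbv (rename ρ t)
normal-cbv-rename ρ (lam t)  = lam _
normal-cbv-rename ρ (es a b) = es (normal-cbv-rename (ext ρ) a) (normal-cbv-rename ρ b)

normal-cbv-no-ExpStep : ∀ {n} {t : Tm (suc n)} {a r} → normal-cbv t → ¬ ExpStep t a r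
normal-cbv-no-ExpStep nt (root x) = normal-cbv-no-Replace nt x
normal-cbv-no-ExpStep nt (push e) = normal-cbv-no-ExpStep (normal-cbv-rename (ext suc) nt) e

normal-cbv-no-Step : ∀ {n k} {t t' : Tm n} → normal-cbv t → ¬ Step k t t'
normal-cbv-no-Step (es a b) (rootE e) = normal-cbv-no-ExpStep a e
normal-cbv-no-Step (es a b) (esL st)  = normal-cbv-no-Step a st
normal-cbv-no-Step (es a b) (esR st)  = normal-cbv-no-Step b st

normal-answer : ∀ {n} {t : Tm n} → normal t →
  Σ ℕ λ k → Σ (SCtx n k) λ S → Σ (Tm (suc (n ⊕ k))) λ b → t ≡ plugS S (lam b)
normal-answer (lam t) = zero , hole , t , refl
normal-answer (es s nt) with normal-answer nt
... | k , S , b , refl = suc k , esL S s , b , refl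

need-appL : ∀ {n} {t t' : Tm n} s → t →need t' → app t s →need app t' s
need-appL s = Sum.map (λ { (ctx E r) → ctx (appL E s) r }) (λ { (ctx E r) → ctx (appL E s) r })

need-esL : ∀ {n} {t t' : Tm (suc n)} s → t →need t' → es t s →need es t' s
need-esL s = Sum.map (λ { (ctx E r) → ctx (esL E s) r }) (λ { (ctx E r) → ctx (esL E s) r })

need-esN : ∀ {n j} (E : ECtx (suc n) j) {s s' : Tm n} → s →need s' →
  es (plugE E (var (wkN j zero))) s →need es (plugE E (var (wkN j zero))) s'
need-esN E = Sum.map (λ { (ctx E' r) → ctx (esN E E') r }) (λ { (ctx E' r) → ctx (esN E E') r })

data NeedProgress {n} (t : Tm n) : Set where
  done  : normal t → NeedProgress t
  step  : ∀ {t'} → t →need t' → NeedProgress t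
  stuck : ∀ j (E : ECtx n j) i → t ≡ plugE E (var (wkN j i)) → NeedProgress t

need-progress : ∀ {n} (t : Tm n) → NeedProgress t
need-progress (var i)   = stuck zero hole i refl
need-progress (lam t)   = done (lam t)
need-progress (app t s) with need-progress t
... | done nt with normal-answer nt
...   | k , S , b , refl = step (inj₁ (ctx hole (rule-m S b s)))
need-progress (app t s) | step x             = step (need-appL s x)
need-progress (app t s) | stuck j E i refl   = stuck j (appL E s) i refl
need-progress (es t s) with need-progress t
... | done nt                  = done (es s nt)
... | step x                   = step (need-esL s x)
... | stuck j E (suc i) refl   = stuck (suc j) (esL E s) i refl
... | stuck j E zero refl with need-progress s
...   | done ns with normal-answer ns
...     | k , S , b , refl = step (inj₂ (ctx hole (rule-e E S b)))
need-progress (es t s) | stuck j E zero refl | step x = step (need-esN E x)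
need-progress (es t s) | stuck j E zero refl | stuck k E' i refl = stuck k (esN E E') i refl

-- CbNeed simulates weak reduction to a CbV normal form, step for step

NeedBounded : ∀ {n} → Tm n → ℕ → ℕ → Set
NeedBounded {n} t m e = Σ (Tm n) λ s → Σ (Star _→need_ t s) λ d' →
  normal s × (∣ d' ∣m ≤ m) × (∣ d' ∣e ≤ e)

open RandomDescent (Step {0}) Step-diamond

need-step : ∀ {n} {t t' : Tm n} → t →need t' → Step⁺ t t'
need-step = Sum.map need-mul-step need-exp-step

size : ∀ {t u : Tm 0} → Steps t u → ℕ
size d = ∣ d ∣m + ∣ d ∣e

size-descends : ∀ {t t₁ u : Tm 0} (p : Step⁺ t t₁) {d₁ : Steps t₁ u} {d : Steps t u} →
  SameCounts (p ◅ d₁) d → suc (size d₁) ≡ size d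
size-descends (inj₁ _) (m , e) = cong₂ _+_ m e
size-descends (inj₂ _) {d₁} (m , e) = trans (sym (+-suc ∣ d₁ ∣m ∣ d₁ ∣e)) (cong₂ _+_ m e)

prepend : ∀ {t t₁ u : Tm 0} (x : t →need t₁) {d₁ : Steps t₁ u} {d : Steps t u} →
  SameCounts (need-step x ◅ d₁) d → NeedBounded t₁ ∣ d₁ ∣m ∣ d₁ ∣e → NeedBounded t ∣ d ∣m ∣ d ∣e
prepend x {d₁} (m , e) (s , d' , ns , m≤ , e≤)
  with cons-map-≤ need-mul-step need-exp-step x {d' = d'} {d = d₁} m≤ e≤
... | m≤' , e≤' = s , x ◅ d' , ns , subst (∣ x ◅ d' ∣m ≤_) m m≤' , subst (∣ x ◅ d' ∣e ≤_) e e≤'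

need-simulates : ∀ fuel {t u : Tm 0} (d : Steps t u) → normal-cbv u → size d < fuel →
  NeedBounded t ∣ d ∣m ∣ d ∣e
need-simulates (suc fuel) {t} d nu (s≤s size≤) with need-progress t
... | done nt         = t , ε , nt , z≤n , z≤n
... | stuck _ _ () _
... | step x with descent⁺ d (normal-cbv-no-Step nu) (need-step x)
...   | d₁ , same =
  prepend x same (need-simulates fuel d₁ nu (subst (_≤ fuel) (sym (size-descends (need-step x) same)) size≤))

corollary2 : (t u : Tm 0) (d : Star _→cbv_ t u) → normal-cbv u →
    Σ (Tm 0) (λ s → Σ (Star _→need_ t s) (λ d' →
    normal s × (∣ d' ∣m ≤ ∣ d ∣m) × (∣ d' ∣e ≤ ∣ d ∣e)))
corollary2 t u d nu =
  subst₂ (NeedBounded t) (mul-eq same) (exp-eq same) (need-simulates (suc (size d⁺)) d⁺ nu ≤-refl)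
  where
  d⁺ : Steps t u
  d⁺ = Star.map (Sum.map cbv-mul-step cbv-exp-step) d
  same : SameCounts d⁺ d
  same = map-counts cbv-mul-step cbv-exp-step d
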